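{- Let $(T,\mu,\eta)$ be a monad on a dagger category $\mathcal{C}$. Then $T$ is a Frobenius monad if and only if the Kleisli category $\mathcal{C}_T$ has a dagger such that (1) the canonical functors $\mathcal{C}\to\mathcal{C}_T$ and $\mathcal{C}_T\to\mathcal{C}$ are dagger functors, and (2) for every object $A$, the morphism $\mu_A^\dagger\colon T(A)\to T^2(A)$ of $\mathcal{C}$, regarded as a morphism $T(A)\to T(A)$ of $\mathcal{C}_T$, is self-adjoint.
   Context: A dagger category has an identity-on-objects contravariant functor $f\mapsto f^\dagger$ with $f^{\dagger\dagger}=f$; a dagger functor $F$ satisfies $F(f^\dagger)=F(f)^\dagger$; an endomorphism $f$ is self-adjoint if $f^\dagger=f$. A Frobenius monad on $\mathcal{C}$ is a monad $(T,\mu,\eta)$ with $T(f^\dagger)=T(f)^\dagger$ for all $f$ and $T(\mu_A)\circ\mu^\dagger_{T(A)}=\mu_{T(A)}\circ T(\mu_A^\dagger)$ for all $A$. The Kleisli category $\mathcal{C}_T$ has the objects of $\mathcal{C}$, morphisms $A\to B$ the morphisms $A\to T(B)$ of $\mathcal{C}$, identities $\eta$, and composition $g\circ_T f=\mu\circ T(g)\circ f$. The canonical functor $\mathcal{C}_T\to\mathcal{C}$ maps $A\mapsto T(A)$, $f\mapsto\mu\circ T(f)$; the canonical functor $\mathcal{C}\to\mathcal{C}_T$ maps $A\mapsto A$, $f\mapsto\eta\circ f$. -}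

module Defs where

open import Level using (Level; _⊔_) renaming (suc to lsuc)
open import Data.Product using (_×_)
open import Relation.Binary.PropositionalEquality
  using (_≡_; refl; sym; trans; cong; cong₂; module ≡-Reasoning)

record Category (o ℓ : Level) : Set (lsuc (o ⊔ ℓ)) where
  infixr 9 _∘_
  field
    Obj       : Set o
    _⇒_       : Obj → Obj → Set ℓ
    id        : ∀ {A} → A ⇒ A
    _∘_       : ∀ {A B C} → B ⇒ C → A ⇒ B → A ⇒ C
    identityˡ : ∀ {A B} (f : A ⇒ B) → id ∘ f ≡ f
    identityʳ : ∀ {A B} (f : A ⇒ B) → f ∘ id ≡ f
    assoc     : ∀ {A B C D} (h : C ⇒ D) (g : B ⇒ C) (f : A ⇒ B) →
                (h ∘ g) ∘ f ≡ h ∘ (g ∘ f)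

record Functor {o ℓ o′ ℓ′} (C : Category o ℓ) (D : Category o′ ℓ′)
       : Set (o ⊔ ℓ ⊔ o′ ⊔ ℓ′) where
  private
    module C = Category C
    module D = Category D
  field
    F₀           : C.Obj → D.Obj
    F₁           : ∀ {A B} → A C.⇒ B → F₀ A D.⇒ F₀ B
    identity     : ∀ {A} → F₁ (C.id {A}) ≡ D.id
    homomorphism : ∀ {A B X} (g : B C.⇒ X) (f : A C.⇒ B) →
                   F₁ (g C.∘ f) ≡ F₁ g D.∘ F₁ f

record Dagger {o ℓ} (C : Category o ℓ) : Set (o ⊔ ℓ) where
  open Category C
  infix 10 _†
  field
    _†            : ∀ {A B} → A ⇒ B → B ⇒ A
    †-identity    : ∀ {A} → (id {A}) † ≡ id
    †-homomorphism : ∀ {A B X} (g : B ⇒ X) (f : A ⇒ B) → (g ∘ f) † ≡ f † ∘ g †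
    †-involutive  : ∀ {A B} (f : A ⇒ B) → (f †) † ≡ f

record DaggerCategory (o ℓ : Level) : Set (lsuc (o ⊔ ℓ)) where
  field
    cat    : Category o ℓ
    dagger : Dagger cat
  open Category cat public
  open Dagger dagger public

IsDaggerFunctor : ∀ {o ℓ o′ ℓ′} {C : Category o ℓ} {D : Category o′ ℓ′} →
                  Dagger C → Dagger D → Functor C D → Set (o ⊔ ℓ ⊔ ℓ′)
IsDaggerFunctor {C = C} DC DD F =
  ∀ {A B} (f : A C.⇒ B) → F₁ (f DC.†) ≡ (F₁ f) DD.†
  where
    module C = Category C
    module DC = Dagger DC
    module DD = Dagger DD
    open Functor F

IsSelfAdjoint : ∀ {o ℓ} {C : Category o ℓ} → Dagger C →
                ∀ {A} → Category._⇒_ C A A → Set ℓ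
IsSelfAdjoint D f = f D.† ≡ f
  where module D = Dagger D

record Monad {o ℓ} (C : Category o ℓ) : Set (o ⊔ ℓ) where
  open Category C
  field
    T : Functor C C
  open Functor T public renaming (F₀ to T₀; F₁ to T₁)
  field
    η : ∀ A → A ⇒ T₀ A
    μ : ∀ A → T₀ (T₀ A) ⇒ T₀ A
    η-natural   : ∀ {A B} (f : A ⇒ B) → T₁ f ∘ η A ≡ η B ∘ f
    μ-natural   : ∀ {A B} (f : A ⇒ B) → T₁ f ∘ μ A ≡ μ B ∘ T₁ (T₁ f)
    μ-assoc     : ∀ A → μ A ∘ T₁ (μ A) ≡ μ A ∘ μ (T₀ A)
    μ-identityˡ : ∀ A → μ A ∘ T₁ (η A) ≡ id
    μ-identityʳ : ∀ A → μ A ∘ η (T₀ A) ≡ id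

IsFrobenius : ∀ {o ℓ} (C : DaggerCategory o ℓ) → Monad (DaggerCategory.cat C) → Set (o ⊔ ℓ)
IsFrobenius C M =
  IsDaggerFunctor (dagger) (dagger) T
  × (∀ A → T₁ (μ A) ∘ (μ (T₀ A)) † ≡ μ (T₀ A) ∘ T₁ ((μ A) †))
  where
    open DaggerCategory C
    open Monad M

module KleisliConstruction {o ℓ} {C : Category o ℓ} (M : Monad C) where
  open Category C
  open Monad M
  open ≡-Reasoning

  kHom : Obj → Obj → Set ℓ
  kHom A B = A ⇒ T₀ B

  _∘K_ : ∀ {A B X} → kHom B X → kHom A B → kHom A X
  _∘K_ {X = X} g f = μ X ∘ (T₁ g ∘ f)

  ext : ∀ {A B} → kHom A B → T₀ A ⇒ T₀ B
  ext {B = B} f = μ B ∘ T₁ f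

  ext-η : ∀ {A} → ext (η A) ≡ id
  ext-η {A} = μ-identityˡ A

  ext-∘ : ∀ {A B X} (g : kHom B X) (f : kHom A B) → ext (g ∘K f) ≡ ext g ∘ ext f
  ext-∘ {A} {B} {X} g f = begin
      μ X ∘ T₁ (μ X ∘ (T₁ g ∘ f))
    ≡⟨ cong (μ X ∘_) (trans (homomorphism (μ X) (T₁ g ∘ f))
                           (cong (T₁ (μ X) ∘_) (homomorphism (T₁ g) f))) ⟩
      μ X ∘ (T₁ (μ X) ∘ (T₁ (T₁ g) ∘ T₁ f))
    ≡⟨ sym (assoc _ _ _) ⟩
      (μ X ∘ T₁ (μ X)) ∘ (T₁ (T₁ g) ∘ T₁ f)
    ≡⟨ cong (_∘ (T₁ (T₁ g) ∘ T₁ f)) (μ-assoc X) ⟩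
      (μ X ∘ μ (T₀ X)) ∘ (T₁ (T₁ g) ∘ T₁ f)
    ≡⟨ assoc _ _ _ ⟩
      μ X ∘ (μ (T₀ X) ∘ (T₁ (T₁ g) ∘ T₁ f))
    ≡⟨ cong (μ X ∘_) (sym (assoc _ _ _)) ⟩
      μ X ∘ ((μ (T₀ X) ∘ T₁ (T₁ g)) ∘ T₁ f)
    ≡⟨ cong (λ z → μ X ∘ (z ∘ T₁ f)) (sym (μ-natural g)) ⟩
      μ X ∘ ((T₁ g ∘ μ B) ∘ T₁ f)
    ≡⟨ cong (μ X ∘_) (assoc _ _ _) ⟩
      μ X ∘ (T₁ g ∘ (μ B ∘ T₁ f))
    ≡⟨ sym (assoc _ _ _) ⟩
      (μ X ∘ T₁ g) ∘ (μ B ∘ T₁ f)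
    ∎

  kIdˡ : ∀ {A B} (f : kHom A B) → η B ∘K f ≡ f
  kIdˡ {B = B} f = begin
      μ B ∘ (T₁ (η B) ∘ f)  ≡⟨ sym (assoc _ _ _) ⟩
      (μ B ∘ T₁ (η B)) ∘ f  ≡⟨ cong (_∘ f) (μ-identityˡ B) ⟩
      id ∘ f                ≡⟨ identityˡ f ⟩
      f                     ∎

  kIdʳ : ∀ {A B} (f : kHom A B) → f ∘K η A ≡ f
  kIdʳ {A} {B} f = begin
      μ B ∘ (T₁ f ∘ η A)     ≡⟨ cong (μ B ∘_) (η-natural f) ⟩
      μ B ∘ (η (T₀ B) ∘ f)   ≡⟨ sym (assoc _ _ _) ⟩
      (μ B ∘ η (T₀ B)) ∘ f   ≡⟨ cong (_∘ f) (μ-identityʳ B) ⟩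
      id ∘ f                 ≡⟨ identityˡ f ⟩
      f                      ∎

  kAssoc : ∀ {A B X Y} (h : kHom X Y) (g : kHom B X) (f : kHom A B) →
           (h ∘K g) ∘K f ≡ h ∘K (g ∘K f)
  kAssoc {Y = Y} h g f = begin
      μ Y ∘ (T₁ (h ∘K g) ∘ f)        ≡⟨ sym (assoc _ _ _) ⟩
      ext (h ∘K g) ∘ f               ≡⟨ cong (_∘ f) (ext-∘ h g) ⟩
      (ext h ∘ ext g) ∘ f            ≡⟨ assoc _ _ _ ⟩
      ext h ∘ (ext g ∘ f)            ≡⟨ cong (ext h ∘_) (assoc _ _ _) ⟩
      (μ Y ∘ T₁ h) ∘ (g ∘K f)        ≡⟨ assoc _ _ _ ⟩
      h ∘K (g ∘K f)                  ∎

  Kleisli : Category o ℓ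
  Kleisli = record
    { Obj = Obj ; _⇒_ = kHom ; id = λ {A} → η A ; _∘_ = _∘K_
    ; identityˡ = kIdˡ ; identityʳ = kIdʳ ; assoc = kAssoc }

  toKleisli : Functor C Kleisli
  toKleisli = record
    { F₀ = λ A → A
    ; F₁ = λ {A} {B} f → η B ∘ f
    ; identity = identityʳ _
    ; homomorphism = hom }
    where
      hom : ∀ {A B X} (g : B ⇒ X) (f : A ⇒ B) →
            η X ∘ (g ∘ f) ≡ (η X ∘ g) ∘K (η B ∘ f)
      hom {A} {B} {X} g f = sym (begin
          μ X ∘ (T₁ (η X ∘ g) ∘ (η B ∘ f))
        ≡⟨ cong (μ X ∘_) (sym (assoc _ _ _)) ⟩
          μ X ∘ ((T₁ (η X ∘ g) ∘ η B) ∘ f)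
        ≡⟨ cong (λ z → μ X ∘ (z ∘ f)) (η-natural (η X ∘ g)) ⟩
          μ X ∘ ((η (T₀ X) ∘ (η X ∘ g)) ∘ f)
        ≡⟨ cong (μ X ∘_) (assoc _ _ _) ⟩
          μ X ∘ (η (T₀ X) ∘ ((η X ∘ g) ∘ f))
        ≡⟨ sym (assoc _ _ _) ⟩
          (μ X ∘ η (T₀ X)) ∘ ((η X ∘ g) ∘ f)
        ≡⟨ cong (_∘ ((η X ∘ g) ∘ f)) (μ-identityʳ X) ⟩
          id ∘ ((η X ∘ g) ∘ f)
        ≡⟨ identityˡ _ ⟩
          (η X ∘ g) ∘ f
        ≡⟨ assoc _ _ _ ⟩
          η X ∘ (g ∘ f)
        ∎)

  fromKleisli : Functor Kleisli C
  fromKleisli = record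
    { F₀ = T₀
    ; F₁ = ext
    ; identity = ext-η
    ; homomorphism = ext-∘ }

open KleisliConstruction public using (Kleisli; toKleisli; fromKleisli)

-- A dagger on the Kleisli category making fromKleisli a dagger functor is determined by
-- fromKleisli, which is faithful (f = ext f ∘ η).  For a Frobenius monad the formula
-- f ↦ T(f†) ∘ μ† ∘ η works: its extension is (ext f)†, because the Frobenius law says
-- precisely that ext (μ†) = μ ∘ T(μ†) is self-adjoint.  Conversely, T = fromKleisli ∘ toKleisli
-- is then a dagger functor, and self-adjointness of μ† in the Kleisli category transports
-- along fromKleisli to self-adjointness of ext (μ†), i.e. to the Frobenius law.
module Submission where

open import Defs
open import Data.Product using (Σ; _×_; _,_)
open import Function.Bundles using (_⇔_; mk⇔)
open import Relation.Binary.PropositionalEquality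
  using (_≡_; sym; trans; cong; cong₂; module ≡-Reasoning)

module LiftDagger {o ℓ o′ ℓ′} {C : Category o ℓ} {D : Category o′ ℓ′}
  (DC : Dagger C) (F : Functor D C)
  (faithful : ∀ {A B} {f g : Category._⇒_ D A B} → Functor.F₁ F f ≡ Functor.F₁ F g → f ≡ g)
  (dag : ∀ {A B} → Category._⇒_ D A B → Category._⇒_ D B A)
  (F-dag : ∀ {A B} (f : Category._⇒_ D A B) → Functor.F₁ F (dag f) ≡ Dagger._† DC (Functor.F₁ F f))
  where
  open Dagger DC
  open Functor F
  private
    module C = Category C
    module D = Category D
  open ≡-Reasoning

  liftDagger : Dagger D
  liftDagger = record
    { _† = dag
    ; †-identity = faithful (begin
        F₁ (dag D.id)      ≡⟨ F-dag D.id ⟩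
        F₁ D.id †          ≡⟨ cong _† identity ⟩
        C.id †             ≡⟨ †-identity ⟩
        C.id               ≡⟨ sym identity ⟩
        F₁ D.id            ∎)
    ; †-homomorphism = λ g f → faithful (begin
        F₁ (dag (g D.∘ f))            ≡⟨ F-dag (g D.∘ f) ⟩
        F₁ (g D.∘ f) †                ≡⟨ cong _† (homomorphism g f) ⟩
        (F₁ g C.∘ F₁ f) †             ≡⟨ †-homomorphism (F₁ g) (F₁ f) ⟩
        F₁ f † C.∘ F₁ g †             ≡⟨ sym (cong₂ C._∘_ (F-dag f) (F-dag g)) ⟩
        F₁ (dag f) C.∘ F₁ (dag g)     ≡⟨ sym (homomorphism (dag f) (dag g)) ⟩
        F₁ (dag f D.∘ dag g)          ∎)
    ; †-involutive = λ f → faithful (begin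
        F₁ (dag (dag f))   ≡⟨ F-dag (dag f) ⟩
        F₁ (dag f) †       ≡⟨ cong _† (F-dag f) ⟩
        F₁ f † †           ≡⟨ †-involutive (F₁ f) ⟩
        F₁ f               ∎)
    }

module KleisliExtension {o ℓ} {C : Category o ℓ} (M : Monad C) where
  open Category C
  open Monad M
  open KleisliConstruction M using (kHom; ext; ext-η)
  open ≡-Reasoning

  ext-∘-η : ∀ {A B} (f : kHom A B) → ext f ∘ η A ≡ f
  ext-∘-η {A} {B} f = begin
    (μ B ∘ T₁ f) ∘ η A     ≡⟨ assoc _ _ _ ⟩
    μ B ∘ (T₁ f ∘ η A)     ≡⟨ cong (μ B ∘_) (η-natural f) ⟩
    μ B ∘ (η (T₀ B) ∘ f)   ≡⟨ sym (assoc _ _ _) ⟩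
    (μ B ∘ η (T₀ B)) ∘ f   ≡⟨ cong (_∘ f) (μ-identityʳ B) ⟩
    id ∘ f                 ≡⟨ identityˡ f ⟩
    f                      ∎

  ext-injective : ∀ {A B} {f g : kHom A B} → ext f ≡ ext g → f ≡ g
  ext-injective {A} {f = f} {g} e =
    trans (sym (ext-∘-η f)) (trans (cong (_∘ η A) e) (ext-∘-η g))

  ext-∘-T₁ : ∀ {A B X} (f : kHom B X) (g : A ⇒ B) → ext (f ∘ g) ≡ ext f ∘ T₁ g
  ext-∘-T₁ {X = X} f g = begin
    μ X ∘ T₁ (f ∘ g)        ≡⟨ cong (μ X ∘_) (homomorphism f g) ⟩
    μ X ∘ (T₁ f ∘ T₁ g)     ≡⟨ sym (assoc _ _ _) ⟩
    (μ X ∘ T₁ f) ∘ T₁ g     ∎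

  ext-T₁-∘ : ∀ {A B X} (g : B ⇒ X) (f : kHom A B) → ext (T₁ g ∘ f) ≡ T₁ g ∘ ext f
  ext-T₁-∘ {B = B} {X} g f = begin
    ext (T₁ g ∘ f)               ≡⟨ ext-∘-T₁ (T₁ g) f ⟩
    (μ X ∘ T₁ (T₁ g)) ∘ T₁ f     ≡⟨ cong (_∘ T₁ f) (sym (μ-natural g)) ⟩
    (T₁ g ∘ μ B) ∘ T₁ f          ≡⟨ assoc _ _ _ ⟩
    T₁ g ∘ ext f                 ∎

  ext-η-∘ : ∀ {A B} (f : A ⇒ B) → ext (η B ∘ f) ≡ T₁ f
  ext-η-∘ {B = B} f = begin
    ext (η B ∘ f)        ≡⟨ ext-∘-T₁ (η B) f ⟩
    ext (η B) ∘ T₁ f     ≡⟨ cong (_∘ T₁ f) ext-η ⟩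
    id ∘ T₁ f            ≡⟨ identityˡ (T₁ f) ⟩
    T₁ f                 ∎

  ext-id : ∀ {A} → ext (id {T₀ A}) ≡ μ A
  ext-id {A} = trans (cong (μ A ∘_) identity) (identityʳ (μ A))

module DaggerKleisli {o ℓ} (C : DaggerCategory o ℓ) (M : Monad (DaggerCategory.cat C)) where
  open DaggerCategory C
  open Monad M
  open KleisliConstruction M using (kHom; ext)
  open KleisliExtension M
  open ≡-Reasoning

  module _ (T-† : IsDaggerFunctor dagger dagger T) where

    †-ext-μ† : ∀ A → ext (μ A †) † ≡ T₁ (μ A) ∘ μ (T₀ A) †
    †-ext-μ† A = begin
      (μ (T₀ A) ∘ T₁ (μ A †)) †        ≡⟨ †-homomorphism _ _ ⟩
      T₁ (μ A †) † ∘ μ (T₀ A) †        ≡⟨ cong (λ h → h † ∘ μ (T₀ A) †) (T-† (μ A)) ⟩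
      T₁ (μ A) † † ∘ μ (T₀ A) †        ≡⟨ cong (_∘ μ (T₀ A) †) (†-involutive (T₁ (μ A))) ⟩
      T₁ (μ A) ∘ μ (T₀ A) †            ∎

    T₁η†-∘-ext-μ† : ∀ A → T₁ (η A †) ∘ ext (μ A †) ≡ μ A
    T₁η†-∘-ext-μ† A = begin
      T₁ (η A †) ∘ ext (μ A †)     ≡⟨ sym (ext-T₁-∘ (η A †) (μ A †)) ⟩
      ext (T₁ (η A †) ∘ μ A †)     ≡⟨ cong (λ h → ext (h ∘ μ A †)) (T-† (η A)) ⟩
      ext (T₁ (η A) † ∘ μ A †)     ≡⟨ cong ext (sym (†-homomorphism (μ A) (T₁ (η A)))) ⟩
      ext ((μ A ∘ T₁ (η A)) †)     ≡⟨ cong (λ h → ext (h †)) (μ-identityˡ A) ⟩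
      ext (id †)                   ≡⟨ cong ext †-identity ⟩
      ext id                       ≡⟨ ext-id ⟩
      μ A                          ∎

    module _ (frobenius : ∀ A → T₁ (μ A) ∘ μ (T₀ A) † ≡ μ (T₀ A) ∘ T₁ (μ A †)) where

      ext-μ†-selfAdjoint : ∀ A → IsSelfAdjoint dagger (ext (μ A †))
      ext-μ†-selfAdjoint A = trans (†-ext-μ† A) (frobenius A)

      ext-μ†-∘-T₁η : ∀ A → ext (μ A †) ∘ T₁ (η A) ≡ μ A †
      ext-μ†-∘-T₁η A = begin
        ext (μ A †) ∘ T₁ (η A)             ≡⟨ cong₂ _∘_ (sym (ext-μ†-selfAdjoint A)) (sym (†-involutive _)) ⟩
        ext (μ A †) † ∘ T₁ (η A) † †       ≡⟨ sym (†-homomorphism _ _) ⟩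
        (T₁ (η A) † ∘ ext (μ A †)) †       ≡⟨ cong (λ h → (h ∘ ext (μ A †)) †) (sym (T-† (η A))) ⟩
        (T₁ (η A †) ∘ ext (μ A †)) †       ≡⟨ cong _† (T₁η†-∘-ext-μ† A) ⟩
        μ A †                              ∎

      kleisli† : ∀ {A B} → kHom A B → kHom B A
      kleisli† {B = B} f = T₁ (f †) ∘ (μ B † ∘ η B)

      ext-kleisli† : ∀ {A B} (f : kHom A B) → ext (kleisli† f) ≡ ext f †
      ext-kleisli† {B = B} f = begin
        ext (T₁ (f †) ∘ (μ B † ∘ η B))      ≡⟨ ext-T₁-∘ (f †) _ ⟩
        T₁ (f †) ∘ ext (μ B † ∘ η B)        ≡⟨ cong (T₁ (f †) ∘_) (ext-∘-T₁ (μ B †) (η B)) ⟩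
        T₁ (f †) ∘ (ext (μ B †) ∘ T₁ (η B)) ≡⟨ cong₂ _∘_ (T-† f) (ext-μ†-∘-T₁η B) ⟩
        T₁ f † ∘ μ B †                      ≡⟨ sym (†-homomorphism (μ B) (T₁ f)) ⟩
        (μ B ∘ T₁ f) †                      ∎

      kleisliDagger : Dagger (Kleisli M)
      kleisliDagger = LiftDagger.liftDagger dagger (fromKleisli M) ext-injective kleisli† ext-kleisli†

      toKleisli-kleisli† : IsDaggerFunctor dagger kleisliDagger (toKleisli M)
      toKleisli-kleisli† {A} {B} f = ext-injective (begin
        ext (η A ∘ f †)               ≡⟨ ext-η-∘ (f †) ⟩
        T₁ (f †)                      ≡⟨ T-† f ⟩
        T₁ f †                        ≡⟨ cong _† (sym (ext-η-∘ f)) ⟩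
        ext (η B ∘ f) †               ≡⟨ sym (ext-kleisli† (η B ∘ f)) ⟩
        ext (kleisli† (η B ∘ f))      ∎)

      fromKleisli-kleisli† : IsDaggerFunctor kleisliDagger dagger (fromKleisli M)
      fromKleisli-kleisli† f = ext-kleisli† f

      μ†-kleisli-selfAdjoint : ∀ A → IsSelfAdjoint kleisliDagger {T₀ A} (μ A †)
      μ†-kleisli-selfAdjoint A =
        ext-injective (trans (ext-kleisli† (μ A †)) (ext-μ†-selfAdjoint A))

  module _ (D : Dagger (Kleisli M))
           (fromKleisli-† : IsDaggerFunctor D dagger (fromKleisli M)) where
    open Dagger D using () renaming (_† to _‡)

    T-†-from-canonical : IsDaggerFunctor dagger D (toKleisli M) → IsDaggerFunctor dagger dagger T
    T-†-from-canonical toKleisli-† {A} {B} f = begin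
      T₁ (f †)              ≡⟨ sym (ext-η-∘ (f †)) ⟩
      ext (η A ∘ f †)       ≡⟨ cong ext (toKleisli-† f) ⟩
      ext ((η B ∘ f) ‡)     ≡⟨ fromKleisli-† (η B ∘ f) ⟩
      ext (η B ∘ f) †       ≡⟨ cong _† (ext-η-∘ f) ⟩
      T₁ f †                ∎

    ext-μ†-selfAdjoint-from-canonical :
      (∀ A → IsSelfAdjoint D {T₀ A} (μ A †)) → ∀ A → IsSelfAdjoint dagger (ext (μ A †))
    ext-μ†-selfAdjoint-from-canonical μ†-selfAdjoint A = begin
      ext (μ A †) †         ≡⟨ sym (fromKleisli-† (μ A †)) ⟩
      ext ((μ A †) ‡)       ≡⟨ cong ext (μ†-selfAdjoint A) ⟩
      ext (μ A †)           ∎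

theorem5p3 : ∀ {o ℓ} (C : DaggerCategory o ℓ) (M : Monad (DaggerCategory.cat C)) →
    IsFrobenius C M ⇔
      Σ (Dagger (Kleisli M)) (λ D →
        IsDaggerFunctor (DaggerCategory.dagger C) D (toKleisli M)
        × IsDaggerFunctor D (DaggerCategory.dagger C) (fromKleisli M)
        × (∀ A → IsSelfAdjoint D {Monad.T₀ M A}
                   (Dagger._† (DaggerCategory.dagger C) (Monad.μ M A))))
theorem5p3 C M = mk⇔
  (λ (T-† , frobenius) →
     kleisliDagger T-† frobenius , toKleisli-kleisli† T-† frobenius
     , fromKleisli-kleisli† T-† frobenius , μ†-kleisli-selfAdjoint T-† frobenius)
  (λ (D , toKleisli-† , fromKleisli-† , μ†-selfAdjoint) →
     let T-† = T-†-from-canonical D fromKleisli-† toKleisli-† in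
     T-† , λ A → trans (sym (†-ext-μ† T-† A))
                       (ext-μ†-selfAdjoint-from-canonical D fromKleisli-† μ†-selfAdjoint A))
  where open DaggerKleisli C M
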